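{- Let $n\ge1$ and let $P_n$ be the path with vertices $t_1,\dots,t_n$ and edges $t_it_{i+1}$, $1\le i\le n-1$. Then the $\Bbbk$-vector space of homology classes in $H(P_n)$ of multidegree $t_1t_2\cdots t_n$ is at most one-dimensional if $n\bmod 3\ne2$, and is zero otherwise.
   Context: Let $\Bbbk$ be a field. For a finite simple graph $\Gamma$ with vertices $t_1,\dots,t_s$, $A=\Bbbk[t_1,\dots,t_s]$; each edge $\{t_i,t_j\}$ gives a degree-1 generator $e_{t_it_j}$; $K(\Gamma)$ is the exterior algebra over $A$ on them with $A$-linear graded-derivation differential $d(e_{t_it_j})=t_it_j$; $H(\Gamma)$ its homology (all homological degrees). $K(\Gamma)$ is multigraded: $c\,m\,e_{i_1}\wedge\dots\wedge e_{i_k}$ ($c\in\Bbbk$, $m$ a monomial) has multidegree $m\,x_{i_1}\cdots x_{i_k}$ with $x_i$ the edge monomial of $e_i$; $d$ preserves it, so $H(\Gamma)$ decomposes into multihomogeneous components. -}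

module Defs where

open import Level using (Level; _⊔_) renaming (suc to lsuc)
open import Data.Nat using (ℕ; zero; suc; _<_; _≤_; _<ᵇ_; _%_)
open import Data.Bool using (Bool; true; false; if_then_else_; _∨_)
open import Data.Fin using (Fin; toℕ; inject₁; _≟_) renaming (suc to fsuc; zero to fzero)
open import Data.Vec using (Vec; lookup; _[_]≔_)
open import Data.Product using (Σ; _×_; _,_)
open import Relation.Nullary using (¬_; does)
open import Algebra.Bundles using (CommutativeRing)

record Field (c ℓ : Level) : Set (lsuc (c ⊔ ℓ)) where
  field
    commutativeRing : CommutativeRing c ℓ
  open CommutativeRing commutativeRing public
  field
    0≉1 : ¬ (0# ≈ 1#)
    inverse : ∀ x → ¬ (x ≈ 0#) → Σ Carrier (λ y → (x * y) ≈ 1#)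

-- Finite graphs: s vertices t_0..t_{s-1} (= t_1..t_s of the paper),
-- E edges e_0..e_{E-1}; edge i joins the two vertices `ends i`.
-- The edges are ordered by their index (this fixes the ordering used for
-- wedge products e_{i1} ∧ ... ∧ e_{ik} with i1 < ... < ik).

record Graph : Set where
  field
    nV   : ℕ
    nE   : ℕ
    ends : Fin nE → Fin nV × Fin nV

-- The path P_n on n = suc m vertices t_1..t_n with edges t_i t_{i+1}:
-- edge i (0-based) joins vertex i and vertex i+1.
Path : ℕ → Graph
Path m = record { nV = suc m ; nE = m ; ends = λ i → inject₁ i , fsuc i }

-- Subsets of edges: S i = true means e_i occurs in the wedge product.

Subset : ℕ → Set
Subset n = Vec Bool n

sumℕ : (n : ℕ) → (Fin n → ℕ) → ℕ
sumℕ zero    f = 0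
sumℕ (suc n) f = f fzero Data.Nat.+ sumℕ n (λ i → f (fsuc i))

countBefore : {n : ℕ} → Subset n → Fin n → ℕ
countBefore {n} S j = sumℕ n (λ i → if lookup S i then (if toℕ i <ᵇ toℕ j then 1 else 0) else 0)

module _ (Γ : Graph) where
  open Graph Γ

  incident : Fin nV → Fin nE → Bool
  incident v i with ends i
  ... | a , b = does (v ≟ a) ∨ does (v ≟ b)

  -- exponent of t_v in the monomial x_S = ∏_{i ∈ S} x_i
  edgeDeg : Subset nE → Fin nV → ℕ
  edgeDeg S v = sumℕ nE (λ i → if lookup S i then (if incident v i then 1 else 0) else 0)

  -- A basis element
  -- m e_S of K(Γ) has multidegree α iff m x_S = α, i.e. iff x_S divides
  -- α (then m = α / x_S is uniquely determined).  So the multidegree-α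
  -- component K(Γ)_α has the k-basis { (α/x_S) e_S : x_S ∣ α }.
  Divides : Subset nE → (Fin nV → ℕ) → Set
  Divides S α = ∀ v → edgeDeg S v ≤ α v

module _ {c ℓ : Level} (F : Field c ℓ) where
  open Field F

  sumF : (n : ℕ) → (Fin n → Carrier) → Carrier
  sumF zero    f = 0#
  sumF (suc n) f = f fzero + sumF n (λ i → f (fsuc i))

  sgn : ℕ → Carrier
  sgn zero    = 1#
  sgn (suc k) = - (sgn k)

  module _ (Γ : Graph) where
    open Graph Γ

    -- An element of the (total, all homological degrees) complex K(Γ),
    -- restricted to a multidegree α, is given by its coefficients
    -- c S ∈ k on the basis elements (α/x_S) e_S.
    Chain : Set c
    Chain = Subset nE → Carrier

    InComponent : (Fin nV → ℕ) → Chain → Set ℓ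
    InComponent α x = ∀ S → ¬ Divides Γ S α → x S ≈ 0#

    -- the Koszul differential on the multidegree-α component:
    -- d((α/x_T) e_T) = Σ_{j ∈ T} (-1)^{#{i ∈ T : i < j}} (α/x_T) x_j e_{T∖j},
    -- so the coefficient of e_S in d x is
    -- Σ_{j ∉ S} (-1)^{#{i ∈ S : i < j}} x(S ∪ {j}).
    dK : Chain → Chain
    dK x S = sumF nE (λ j → if lookup S j then 0#
                             else sgn (countBefore S j) * x (S [ j ]≔ true))

    HomologyDimAtMostOne : (Fin nV → ℕ) → Set (c ⊔ ℓ)
    HomologyDimAtMostOne α =
      Σ Chain (λ z → InComponent α z × (∀ S → dK z S ≈ 0#) ×
        (∀ x → InComponent α x → (∀ S → dK x S ≈ 0#) →
           Σ Carrier (λ a → Σ Chain (λ b → InComponent α b ×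
             (∀ S → x S ≈ (a * z S) + dK b S)))))

    HomologyZero : (Fin nV → ℕ) → Set (c ⊔ ℓ)
    HomologyZero α =
      ∀ x → InComponent α x → (∀ S → dK x S ≈ 0#) →
        Σ Chain (λ b → InComponent α b × (∀ S → x S ≈ dK b S))

allOnes : (n : ℕ) → Fin n → ℕ
allOnes n v = 1

module Submission where

-- In multidegree t₁⋯tₙ the basis chain e_S survives only when S is a matching of Pₙ, and
-- splitting off the first edge exhibits the complex as a mapping cone:
-- d(a ⊕ b) = (b + d a) ⊕ (− d b).  Hence a supported cycle x is homologous to (e₁ − e₀) ∧ w,
-- w being the part of x containing e₁ but not e₀: subtract the boundary of e₀ ∧ x₀₀, x₀₀ the
-- part of x free of e₀ and e₁.  In a matching e₁ excludes e₂, so w is a cycle y on the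
-- edges beyond e₂, and y ↦ (e₁ − e₀) ∧ y, which anticommutes with d because e₁ − e₀ is a
-- cycle of degree one, maps the homology of P_{k+1} onto that of P_{k+4}.  The induction of
-- period three starts from H(P₁) = 𝕜, H(P₂) = 0 and H(P₃) spanned by e₁ − e₀.

open import Defs
open import Level using (Level; _⊔_)
open import Data.Nat using (ℕ; zero; suc; _%_)
open import Data.Nat.DivMod using (%-remove-+ˡ)
open import Data.Nat.Divisibility using (∣-refl)
open import Data.Bool using (Bool; true; false; if_then_else_)
open import Data.Fin using (Fin) renaming (zero to fzero; suc to fsuc)
open import Data.Vec using (_∷_; []; lookup)
open import Data.Product using (Σ; _×_; _,_)
open import Data.Empty using (⊥-elim)
open import Function using (_∘_)
open import Relation.Nullary using (¬_)
open import Relation.Binary.PropositionalEquality as ≡ using (_≡_; _≢_)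
import Algebra.Properties.Ring as RingProperties
import Algebra.Properties.CommutativeSemigroup as CommutativeSemigroupProperties

module Matchings where
  open import Data.Nat using (_+_; _≤_; z≤n; s≤s)
  open import Data.Nat.Properties using (≤-trans; m≤n+m)
  open ≡ using (refl; cong; cong₂; subst; sym)

  -- x_S divides t₁⋯tₙ exactly when S is a matching of the path.
  IsMatching : (m : ℕ) → Subset m → Set
  IsMatching m S = Divides (Path m) S (allOnes (suc m))

  sumℕ-zero : ∀ n (f : Fin n → ℕ) → (∀ i → f i ≡ 0) → sumℕ n f ≡ 0
  sumℕ-zero zero    f f≡0 = refl
  sumℕ-zero (suc n) f f≡0 = cong₂ _+_ (f≡0 fzero) (sumℕ-zero n (λ i → f (fsuc i)) (λ i → f≡0 (fsuc i)))

  if-const : ∀ {a} {A : Set a} (b : Bool) (x : A) → (if b then x else x) ≡ x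
  if-const true  x = refl
  if-const false x = refl

  edgeDeg-first : ∀ {m} b (S : Subset m) → edgeDeg (Path (suc m)) (b ∷ S) fzero ≡ (if b then 1 else 0) + 0
  edgeDeg-first {m} b S = cong ((if b then 1 else 0) +_) (sumℕ-zero m _ (λ i → if-const (lookup S i) 0))

  isMatching-[] : IsMatching 0 []
  isMatching-[] _ = z≤n

  isMatching-tail : ∀ {m} b (S : Subset m) → IsMatching (suc m) (b ∷ S) → IsMatching m S
  isMatching-tail b S M v = ≤-trans (m≤n+m _ _) (M (fsuc v))

  isMatching-false∷ : ∀ {m} (S : Subset m) → IsMatching m S → IsMatching (suc m) (false ∷ S)
  isMatching-false∷ S M fzero    = subst (_≤ 1) (sym (edgeDeg-first false S)) z≤n
  isMatching-false∷ S M (fsuc v) = M v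

  isMatching-true∷[] : IsMatching 1 (true ∷ [])
  isMatching-true∷[] fzero        = s≤s z≤n
  isMatching-true∷[] (fsuc fzero) = s≤s z≤n

  isMatching-true∷false∷ : ∀ {m} (S : Subset m) → IsMatching m S → IsMatching (suc (suc m)) (true ∷ false ∷ S)
  isMatching-true∷false∷ S M fzero           = subst (_≤ 1) (sym (edgeDeg-first true (false ∷ S))) (s≤s z≤n)
  isMatching-true∷false∷ S M (fsuc fzero)    = subst (_≤ 1) (sym (cong suc (edgeDeg-first false S))) (s≤s z≤n)
  isMatching-true∷false∷ S M (fsuc (fsuc v)) = M v

  ¬isMatching-true∷true∷ : ∀ {m} (S : Subset m) → ¬ IsMatching (suc (suc m)) (true ∷ true ∷ S)
  ¬isMatching-true∷true∷ S M with subst (_≤ 1) (cong suc (edgeDeg-first true S)) (M (fsuc fzero))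
  ... | s≤s ()

  -- S is a matching of P_{m+1} that leaves the first vertex uncovered.
  IsMatchingFreeAtStart : (m : ℕ) → Subset m → Set
  IsMatchingFreeAtStart m S = IsMatching (suc m) (true ∷ S)

open Matchings

module PathKoszul {c ℓ : Level} (F : Field c ℓ) where
  open Field F
  open RingProperties ring
    using (-0#≈0#; -‿+-comm; -‿involutive; -‿distribˡ-*; -‿distribʳ-*; x+x≈x⇒x≈0; +-inverseˡ-unique)
  open CommutativeSemigroupProperties +-commutativeSemigroup using (interchange)
  open import Relation.Binary.Reasoning.Setoid setoid

  PathChain : ℕ → Set c
  PathChain m = Chain F (Path m)

  ∂ : ∀ {m} → PathChain m → PathChain m
  ∂ {m} = dK F (Path m)

  0ᶜ : ∀ {m} → PathChain m
  0ᶜ _ = 0#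

  _·ᶜ_ : ∀ {m} → Carrier → PathChain m → PathChain m
  (a ·ᶜ x) S = a * x S

  Cycle : ∀ {m} → PathChain m → Set ℓ
  Cycle x = ∀ S → ∂ x S ≈ 0#

  VanishesOff : ∀ {m} → (Subset m → Set) → PathChain m → Set ℓ
  VanishesOff Z x = ∀ S → ¬ Z S → x S ≈ 0#

  Supported : ∀ {m} → PathChain m → Set ℓ
  Supported {m} = VanishesOff (IsMatching m)

  Homologous : ∀ {m} → (Subset m → Set) → PathChain m → PathChain m → Set (c ⊔ ℓ)
  Homologous {m} Z x x′ = Σ (PathChain m) λ b → VanishesOff Z b × (∀ S → x S ≈ x′ S + ∂ b S)

  Additive : ∀ {m n} → (PathChain m → PathChain n) → Set (c ⊔ ℓ)
  Additive f = ∀ {y u v} → (∀ S → y S ≈ u S + v S) → ∀ T → f y T ≈ f u T + f v T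

  module _ {m n} {f : PathChain m → PathChain n} (f-additive : Additive f) where

    additive-vanishes : ∀ {y} → (∀ S → y S ≈ 0#) → ∀ T → f y T ≈ 0#
    additive-vanishes {y} y≈0 = x+x≈x⇒x≈0 _ ∘ sym ∘ f-additive y≈y+y
      where
      y≈y+y : ∀ S → y S ≈ y S + y S
      y≈y+y S = trans (y≈0 S) (sym (trans (+-cong (y≈0 S) (y≈0 S)) (+-identityˡ 0#)))

    additive-cong : ∀ {y u} → (∀ S → y S ≈ u S) → ∀ T → f y T ≈ f u T
    additive-cong y≈u T = trans (f-additive (λ S → trans (y≈u S) (sym (+-identityʳ _))) T)
                                (trans (+-congˡ (additive-vanishes (λ _ → refl) T)) (+-identityʳ _))

    additive-neg : ∀ y T → f (λ S → - y S) T ≈ - f y T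
    additive-neg y T = +-inverseˡ-unique _ _
      (trans (sym (f-additive (λ _ → refl) T)) (additive-vanishes (λ S → -‿inverseˡ (y S)) T))

  sumF-cong : ∀ n {f g : Fin n → Carrier} → (∀ i → f i ≈ g i) → sumF F n f ≈ sumF F n g
  sumF-cong zero    f≈g = refl
  sumF-cong (suc n) f≈g = +-cong (f≈g fzero) (sumF-cong n (f≈g ∘ fsuc))

  sumF-+ : ∀ n (f g : Fin n → Carrier) → sumF F n (λ i → f i + g i) ≈ sumF F n f + sumF F n g
  sumF-+ zero    f g = sym (+-identityˡ 0#)
  sumF-+ (suc n) f g = trans (+-congˡ (sumF-+ n (f ∘ fsuc) (g ∘ fsuc))) (interchange _ _ _ _)

  sumF-neg : ∀ n (f : Fin n → Carrier) → sumF F n (λ i → - f i) ≈ - sumF F n f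
  sumF-neg zero    f = sym -0#≈0#
  sumF-neg (suc n) f = trans (+-congˡ (sumF-neg n (f ∘ fsuc))) (-‿+-comm _ _)

  ∂-additive : ∀ {m} → Additive (∂ {m})
  ∂-additive {m} y≈u+v S = trans (sumF-cong m (λ j → summand (lookup S j) (y≈u+v _))) (sumF-+ m _ _)
    where
    summand : ∀ b {s p q r} → p ≈ q + r →
              (if b then 0# else s * p) ≈ (if b then 0# else s * q) + (if b then 0# else s * r)
    summand true      _       = sym (+-identityˡ 0#)
    summand false {s} p≈q+r = trans (*-congˡ p≈q+r) (distribˡ s _ _)

  ∂-false∷ : ∀ {m} (x : PathChain (suc m)) S → ∂ x (false ∷ S) ≈ x (true ∷ S) + ∂ (x ∘ (false ∷_)) S
  ∂-false∷ {m} x S =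
    +-congʳ (trans (*-congʳ (reflexive (≡.cong (sgn F) (sumℕ-zero m _ (λ i → if-const (lookup S i) 0)))))
                   (*-identityˡ _))

  ∂-true∷ : ∀ {m} (x : PathChain (suc m)) S → ∂ x (true ∷ S) ≈ - ∂ (x ∘ (true ∷_)) S
  ∂-true∷ {m} x S = trans (+-identityˡ _) (trans (sumF-cong m (λ j → summand (lookup S j))) (sumF-neg m _))
    where
    summand : ∀ b {s y} → (if b then 0# else (- s) * y) ≈ - (if b then 0# else s * y)
    summand true  = sym -0#≈0#
    summand false = sym (-‿distribˡ-* _ _)

  ∂-0ᶜ : ∀ {m} (S : Subset m) → ∂ 0ᶜ S ≈ 0#
  ∂-0ᶜ = additive-vanishes ∂-additive (λ _ → refl)

  ∂-true∷-vanishes : ∀ {m} (x : PathChain (suc m)) → (∀ U → x (true ∷ U) ≈ 0#) →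
    ∀ S → ∂ x (true ∷ S) ≈ 0#
  ∂-true∷-vanishes x x₁≈0 S =
    trans (∂-true∷ x S) (trans (-‿cong (additive-vanishes ∂-additive x₁≈0 S)) -0#≈0#)

  vanishesOff-+ : ∀ {m} {Z : Subset m → Set} {x y} → VanishesOff Z x → VanishesOff Z y →
    VanishesOff Z (λ S → x S + y S)
  vanishesOff-+ x≈0 y≈0 S ¬Z = trans (+-cong (x≈0 S ¬Z) (y≈0 S ¬Z)) (+-identityˡ 0#)

  vanishesOff-neg : ∀ {m} {Z : Subset m → Set} {x} → VanishesOff Z x → VanishesOff Z (λ S → - x S)
  vanishesOff-neg x≈0 S ¬Z = trans (-‿cong (x≈0 S ¬Z)) -0#≈0#

  homologous-trans : ∀ {m} {Z : Subset m → Set} {x y w} → Homologous Z x y → Homologous Z y w → Homologous Z x w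
  homologous-trans {x = x} {y} {w} (b , Zb , x≈y+∂b) (b′ , Zb′ , y≈w+∂b′) =
    (λ S → b′ S + b S) , vanishesOff-+ Zb′ Zb , λ S → begin
      x S                        ≈⟨ x≈y+∂b S ⟩
      y S + ∂ b S                ≈⟨ +-congʳ (y≈w+∂b′ S) ⟩
      (w S + ∂ b′ S) + ∂ b S     ≈⟨ +-assoc _ _ _ ⟩
      w S + (∂ b′ S + ∂ b S)     ≈⟨ +-congˡ (∂-additive {u = b′} {v = b} (λ _ → refl) S) ⟨
      w S + ∂ (λ U → b′ U + b U) S ∎

  homologous-≈ʳ : ∀ {m} {Z : Subset m → Set} {x y w} → Homologous Z x y → (∀ S → y S ≈ w S) →
    Homologous Z x w
  homologous-≈ʳ (b , Zb , x≈y+∂b) y≈w = b , Zb , λ S → trans (x≈y+∂b S) (+-congʳ (y≈w S))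

  homologous-image : ∀ {m n} {Z : Subset m → Set} {Z′ : Subset n → Set} (f g : PathChain m → PathChain n) →
    Additive f → (∀ b T → f (∂ b) T ≈ ∂ (g b) T) → (∀ {b} → VanishesOff Z b → VanishesOff Z′ (g b)) →
    ∀ {y y′} → Homologous Z y y′ → Homologous Z′ (f y) (f y′)
  homologous-image f g f-additive f∂≈∂g g-vanishes (b , Zb , y≈y′+∂b) =
    g b , g-vanishes Zb , λ T → trans (f-additive y≈y′+∂b T) (+-congˡ (f∂≈∂g b T))

  shift : ∀ {m} → PathChain m → PathChain (suc m)
  shift y (false ∷ S) = y S
  shift y (true ∷ S)  = 0#

  shift-additive : ∀ {m} → Additive (shift {m})
  shift-additive y≈u+v (false ∷ S) = y≈u+v S
  shift-additive y≈u+v (true ∷ S)  = sym (+-identityˡ 0#)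

  shift-· : ∀ {m} a (y : PathChain m) T → shift (a ·ᶜ y) T ≈ (a ·ᶜ shift y) T
  shift-· a y (false ∷ S) = refl
  shift-· a y (true ∷ S)  = sym (zeroʳ a)

  ∂-shift : ∀ {m} (y : PathChain m) T → ∂ (shift y) T ≈ shift (∂ y) T
  ∂-shift y (false ∷ S) = trans (∂-false∷ (shift y) S) (+-identityˡ _)
  ∂-shift y (true ∷ S)  = ∂-true∷-vanishes (shift y) (λ _ → refl) S

  shift-supported : ∀ {m} {y : PathChain m} → Supported y → VanishesOff (IsMatchingFreeAtStart (suc m)) (shift y)
  shift-supported y≈0 (false ∷ S) ¬M = y≈0 S (λ M → ¬M (isMatching-true∷false∷ S M))
  shift-supported y≈0 (true ∷ S)  ¬M = refl

  shift-homologous : ∀ {m} {y y′ : PathChain m} → Homologous (IsMatching m) y y′ →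
    Homologous (IsMatchingFreeAtStart (suc m)) (shift y) (shift y′)
  shift-homologous = homologous-image shift shift shift-additive (λ b T → sym (∂-shift b T)) shift-supported

  shift-cycle : ∀ {m} {y : PathChain m} → Cycle y → Cycle (shift y)
  shift-cycle {y = y} ∂y≈0 T = trans (∂-shift y T) (additive-vanishes shift-additive ∂y≈0 T)

  [e₁-e₀]∧_ : ∀ {m} → PathChain m → PathChain (suc (suc m))
  ([e₁-e₀]∧ w) (false ∷ false ∷ S) = 0#
  ([e₁-e₀]∧ w) (false ∷ true ∷ S)  = w S
  ([e₁-e₀]∧ w) (true ∷ false ∷ S)  = - w S
  ([e₁-e₀]∧ w) (true ∷ true ∷ S)   = 0#

  [e₁-e₀]∧-additive : ∀ {m} → Additive ([e₁-e₀]∧_ {m})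
  [e₁-e₀]∧-additive y≈u+v (false ∷ false ∷ S) = sym (+-identityˡ 0#)
  [e₁-e₀]∧-additive y≈u+v (false ∷ true ∷ S)  = y≈u+v S
  [e₁-e₀]∧-additive y≈u+v (true ∷ false ∷ S)  = trans (-‿cong (y≈u+v S)) (sym (-‿+-comm _ _))
  [e₁-e₀]∧-additive y≈u+v (true ∷ true ∷ S)   = sym (+-identityˡ 0#)

  [e₁-e₀]∧-· : ∀ {m} a (w : PathChain m) T → ([e₁-e₀]∧ (a ·ᶜ w)) T ≈ (a ·ᶜ ([e₁-e₀]∧ w)) T
  [e₁-e₀]∧-· a w (false ∷ false ∷ S) = sym (zeroʳ a)
  [e₁-e₀]∧-· a w (false ∷ true ∷ S)  = refl
  [e₁-e₀]∧-· a w (true ∷ false ∷ S)  = -‿distribʳ-* a (w S)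
  [e₁-e₀]∧-· a w (true ∷ true ∷ S)   = sym (zeroʳ a)

  ∂-[e₁-e₀]∧ : ∀ {m} (w : PathChain m) T → ∂ ([e₁-e₀]∧ w) T ≈ - ([e₁-e₀]∧ ∂ w) T
  ∂-[e₁-e₀]∧ w (false ∷ false ∷ S) = begin
    ∂ ([e₁-e₀]∧ w) (false ∷ false ∷ S)   ≈⟨ ∂-false∷ ([e₁-e₀]∧ w) (false ∷ S) ⟩
    - w S + ∂ (([e₁-e₀]∧ w) ∘ (false ∷_)) (false ∷ S)
                                         ≈⟨ +-congˡ (∂-false∷ (([e₁-e₀]∧ w) ∘ (false ∷_)) S) ⟩
    - w S + (w S + ∂ 0ᶜ S)               ≈⟨ +-congˡ (trans (+-congˡ (∂-0ᶜ S)) (+-identityʳ _)) ⟩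
    - w S + w S                          ≈⟨ -‿inverseˡ (w S) ⟩
    0#                                   ≈⟨ -0#≈0# ⟨
    - 0#                                 ∎
  ∂-[e₁-e₀]∧ w (false ∷ true ∷ S) =
    trans (∂-false∷ ([e₁-e₀]∧ w) (true ∷ S))
          (trans (+-identityˡ _) (∂-true∷ (([e₁-e₀]∧ w) ∘ (false ∷_)) S))
  ∂-[e₁-e₀]∧ w (true ∷ false ∷ S) = trans (∂-true∷ ([e₁-e₀]∧ w) (false ∷ S)) (-‿cong
    (trans (∂-false∷ (([e₁-e₀]∧ w) ∘ (true ∷_)) S) (trans (+-identityˡ _) (additive-neg ∂-additive w S))))
  ∂-[e₁-e₀]∧ w (true ∷ true ∷ S) =
    trans (∂-true∷ ([e₁-e₀]∧ w) (true ∷ S))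
          (-‿cong (∂-true∷-vanishes (([e₁-e₀]∧ w) ∘ (true ∷_)) (λ _ → refl) S))

  [e₁-e₀]∧-supported : ∀ {m} {w : PathChain m} → VanishesOff (IsMatchingFreeAtStart m) w →
    Supported ([e₁-e₀]∧ w)
  [e₁-e₀]∧-supported w≈0 (false ∷ false ∷ S) ¬M = refl
  [e₁-e₀]∧-supported w≈0 (false ∷ true ∷ S)  ¬M = w≈0 S (λ M → ¬M (isMatching-false∷ (true ∷ S) M))
  [e₁-e₀]∧-supported w≈0 (true ∷ false ∷ S)  ¬M =
    vanishesOff-neg w≈0 S (λ M → ¬M (isMatching-true∷false∷ S (isMatching-tail true S M)))
  [e₁-e₀]∧-supported w≈0 (true ∷ true ∷ S)   ¬M = refl

  [e₁-e₀]∧-homologous : ∀ {m} {w w′ : PathChain m} → Homologous (IsMatchingFreeAtStart m) w w′ →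
    Homologous (IsMatching (suc (suc m))) ([e₁-e₀]∧ w) ([e₁-e₀]∧ w′)
  [e₁-e₀]∧-homologous = homologous-image [e₁-e₀]∧_ (λ b T → - ([e₁-e₀]∧ b) T) [e₁-e₀]∧-additive
    (λ b T → trans (sym (-‿involutive _)) (trans (-‿cong (sym (∂-[e₁-e₀]∧ b T)))
                                                   (sym (additive-neg ∂-additive ([e₁-e₀]∧ b) T))))
    (vanishesOff-neg ∘ [e₁-e₀]∧-supported)

  [e₁-e₀]∧-cycle : ∀ {m} {w : PathChain m} → Cycle w → Cycle ([e₁-e₀]∧ w)
  [e₁-e₀]∧-cycle {w = w} ∂w≈0 T =
    trans (∂-[e₁-e₀]∧ w T) (trans (-‿cong (additive-vanishes [e₁-e₀]∧-additive ∂w≈0 T)) -0#≈0#)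

  e₁-part : ∀ {m} → PathChain (suc (suc m)) → PathChain m
  e₁-part x S = x (false ∷ true ∷ S)

  module _ {m} {x : PathChain (suc (suc m))} (x-supported : Supported x) (x-cycle : Cycle x) where

    e₁-part-freeAtStart : VanishesOff (IsMatchingFreeAtStart m) (e₁-part x)
    e₁-part-freeAtStart S ¬M = x-supported (false ∷ true ∷ S) (¬M ∘ isMatching-tail false (true ∷ S))

    e₁-part-cycle : Cycle (e₁-part x)
    e₁-part-cycle S = begin
      ∂ (e₁-part x) S                         ≈⟨ -‿involutive _ ⟨
      - (- ∂ (e₁-part x) S)                   ≈⟨ -‿cong (∂-true∷ (x ∘ (false ∷_)) S) ⟨
      - ∂ (x ∘ (false ∷_)) (true ∷ S)         ≈⟨ -‿cong (+-identityˡ _) ⟨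
      - (0# + ∂ (x ∘ (false ∷_)) (true ∷ S))  ≈⟨ -‿cong (+-congʳ (x-supported _ (¬isMatching-true∷true∷ S))) ⟨
      - (x (true ∷ true ∷ S) + ∂ (x ∘ (false ∷_)) (true ∷ S)) ≈⟨ -‿cong (∂-false∷ x (true ∷ S)) ⟨
      - ∂ x (false ∷ true ∷ S)                ≈⟨ -‿cong (x-cycle (false ∷ true ∷ S)) ⟩
      - 0#                                    ≈⟨ -0#≈0# ⟩
      0#                                      ∎

    homologous-to-[e₁-e₀]∧ : Homologous (IsMatching (suc (suc m))) x ([e₁-e₀]∧ e₁-part x)
    homologous-to-[e₁-e₀]∧ = b , b-supported , decompose
      where
      x₀₀ : PathChain m
      x₀₀ S = x (false ∷ false ∷ S)

      b : PathChain (suc (suc m))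
      b (false ∷ S)        = 0#
      b (true ∷ false ∷ S) = x₀₀ S
      b (true ∷ true ∷ S)  = 0#

      b-supported : Supported b
      b-supported (false ∷ S)        ¬M = refl
      b-supported (true ∷ false ∷ S) ¬M = x-supported (false ∷ false ∷ S)
        (¬M ∘ isMatching-true∷false∷ S ∘ isMatching-tail false S ∘ isMatching-tail false (false ∷ S))
      b-supported (true ∷ true ∷ S)  ¬M = refl

      ∂0ᶜ≈0 : ∀ {k} S → 0# + ∂ {k} 0ᶜ S ≈ 0#
      ∂0ᶜ≈0 S = trans (+-identityˡ _) (∂-0ᶜ S)

      x-true∷false∷ : ∀ S → x (true ∷ false ∷ S) ≈ - e₁-part x S + - ∂ x₀₀ S
      x-true∷false∷ S = trans (+-inverseˡ-unique _ _ (begin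
        x (true ∷ false ∷ S) + (e₁-part x S + ∂ x₀₀ S) ≈⟨ +-congˡ (∂-false∷ (x ∘ (false ∷_)) S) ⟨
        x (true ∷ false ∷ S) + ∂ (x ∘ (false ∷_)) (false ∷ S) ≈⟨ ∂-false∷ x (false ∷ S) ⟨
        ∂ x (false ∷ false ∷ S)                ≈⟨ x-cycle (false ∷ false ∷ S) ⟩
        0#                                     ∎)) (sym (-‿+-comm _ _))

      decompose : ∀ T → x T ≈ ([e₁-e₀]∧ e₁-part x) T + ∂ b T
      decompose (false ∷ false ∷ S) = sym (begin
        0# + ∂ b (false ∷ false ∷ S)           ≈⟨ +-identityˡ _ ⟩
        ∂ b (false ∷ false ∷ S)                ≈⟨ ∂-false∷ b (false ∷ S) ⟩
        x₀₀ S + ∂ 0ᶜ (false ∷ S)               ≈⟨ +-congˡ (∂-0ᶜ (false ∷ S)) ⟩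
        x₀₀ S + 0#                             ≈⟨ +-identityʳ _ ⟩
        x₀₀ S                                  ∎)
      decompose (false ∷ true ∷ S) =
        sym (trans (+-congˡ (trans (∂-false∷ b (true ∷ S)) (∂0ᶜ≈0 (true ∷ S)))) (+-identityʳ _))
      decompose (true ∷ false ∷ S) = trans (x-true∷false∷ S) (+-congˡ (sym (begin
        ∂ b (true ∷ false ∷ S)                 ≈⟨ ∂-true∷ b (false ∷ S) ⟩
        - ∂ (b ∘ (true ∷_)) (false ∷ S)        ≈⟨ -‿cong (∂-false∷ (b ∘ (true ∷_)) S) ⟩
        - (0# + ∂ x₀₀ S)                       ≈⟨ -‿cong (+-identityˡ _) ⟩
        - ∂ x₀₀ S                              ∎)))
      decompose (true ∷ true ∷ S) = trans (x-supported _ (¬isMatching-true∷true∷ S)) (sym (begin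
        0# + ∂ b (true ∷ true ∷ S)             ≈⟨ +-identityˡ _ ⟩
        ∂ b (true ∷ true ∷ S)                  ≈⟨ ∂-true∷ b (true ∷ S) ⟩
        - ∂ (b ∘ (true ∷_)) (true ∷ S)         ≈⟨ -‿cong (∂-true∷-vanishes (b ∘ (true ∷_)) (λ _ → refl) S) ⟩
        - 0#                                   ≈⟨ -0#≈0# ⟩
        0#                                     ∎))

  freeAtStart≈shift : ∀ {m} {w : PathChain (suc m)} → VanishesOff (IsMatchingFreeAtStart (suc m)) w →
    ∀ T → w T ≈ shift (w ∘ (false ∷_)) T
  freeAtStart≈shift w≈0 (false ∷ S) = refl
  freeAtStart≈shift w≈0 (true ∷ S)  = w≈0 (true ∷ S) (¬isMatching-true∷true∷ S)

  freeAtStart-tail-supported : ∀ {m} {w : PathChain (suc m)} → VanishesOff (IsMatchingFreeAtStart (suc m)) w →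
    Supported (w ∘ (false ∷_))
  freeAtStart-tail-supported w≈0 S ¬M =
    w≈0 (false ∷ S) (¬M ∘ isMatching-tail false S ∘ isMatching-tail true (false ∷ S))

  lift : ∀ {m} → PathChain m → PathChain (suc (suc (suc m)))
  lift y = [e₁-e₀]∧ shift y

  lift-additive : ∀ {m} → Additive (lift {m})
  lift-additive = [e₁-e₀]∧-additive ∘ shift-additive

  lift-· : ∀ {m} a (y : PathChain m) T → lift (a ·ᶜ y) T ≈ (a ·ᶜ lift y) T
  lift-· a y T = trans (additive-cong [e₁-e₀]∧-additive (shift-· a y) T) ([e₁-e₀]∧-· a (shift y) T)

  lift-supported : ∀ {m} {y : PathChain m} → Supported y → Supported (lift y)
  lift-supported = [e₁-e₀]∧-supported ∘ shift-supported

  lift-cycle : ∀ {m} {y : PathChain m} → Cycle y → Cycle (lift y)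
  lift-cycle = [e₁-e₀]∧-cycle ∘ shift-cycle

  lift-homologous : ∀ {m} {y y′ : PathChain m} → Homologous (IsMatching m) y y′ →
    Homologous (IsMatching (suc (suc (suc m)))) (lift y) (lift y′)
  lift-homologous = [e₁-e₀]∧-homologous ∘ shift-homologous

  cycle-homologous-to-lift : ∀ {m} {x : PathChain (suc (suc (suc m)))} → Supported x → Cycle x →
    Σ (PathChain m) λ y → Supported y × Cycle y × Homologous (IsMatching (suc (suc (suc m)))) x (lift y)
  cycle-homologous-to-lift {m} {x} x-supported x-cycle =
    y , freeAtStart-tail-supported w-free , y-cycle ,
    homologous-≈ʳ (homologous-to-[e₁-e₀]∧ x-supported x-cycle) (additive-cong [e₁-e₀]∧-additive w≈shift-y)
    where
    w : PathChain (suc m)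
    w = e₁-part x
    y : PathChain m
    y = w ∘ (false ∷_)
    w-free : VanishesOff (IsMatchingFreeAtStart (suc m)) w
    w-free = e₁-part-freeAtStart x-supported x-cycle
    w≈shift-y : ∀ T → w T ≈ shift y T
    w≈shift-y = freeAtStart≈shift w-free
    y-cycle : Cycle y
    y-cycle S = begin
      ∂ y S                       ≈⟨ ∂-shift y (false ∷ S) ⟨
      ∂ (shift y) (false ∷ S)     ≈⟨ additive-cong ∂-additive (sym ∘ w≈shift-y) (false ∷ S) ⟩
      ∂ w (false ∷ S)             ≈⟨ e₁-part-cycle x-supported x-cycle (false ∷ S) ⟩
      0#                          ∎

  DimAtMostOne : ℕ → Set (c ⊔ ℓ)
  DimAtMostOne m = HomologyDimAtMostOne F (Path m) (allOnes (suc m))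

  Acyclic : ℕ → Set (c ⊔ ℓ)
  Acyclic m = HomologyZero F (Path m) (allOnes (suc m))

  dimAtMostOne-0 : DimAtMostOne 0
  dimAtMostOne-0 = (λ _ → 1#) , (λ _ ¬M → ⊥-elim (¬M isMatching-[])) , (λ _ → refl) ,
    λ x _ _ → x [] , 0ᶜ , (λ _ _ → refl) , λ { [] → sym (trans (+-identityʳ _) (*-identityʳ _)) }

  acyclic-1 : Acyclic 1
  acyclic-1 x _ x-cycle = b , b-supported , x≈∂b
    where
    b : PathChain 1
    b (false ∷ []) = 0#
    b (true ∷ [])  = x (false ∷ [])
    b-supported : Supported b
    b-supported (false ∷ []) ¬M = refl
    b-supported (true ∷ [])  ¬M = ⊥-elim (¬M isMatching-true∷[])
    x≈∂b : ∀ S → x S ≈ ∂ b S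
    x≈∂b (false ∷ []) = sym (trans (∂-false∷ b []) (+-identityʳ _))
    x≈∂b (true ∷ [])  = begin
      x (true ∷ [])              ≈⟨ +-identityʳ _ ⟨
      x (true ∷ []) + 0#         ≈⟨ ∂-false∷ x [] ⟨
      ∂ x (false ∷ [])           ≈⟨ x-cycle (false ∷ []) ⟩
      0#                         ≈⟨ -0#≈0# ⟨
      - 0#                       ≈⟨ ∂-true∷ b [] ⟨
      ∂ b (true ∷ [])            ∎

  dimAtMostOne-2 : DimAtMostOne 2
  dimAtMostOne-2 = [e₁-e₀]∧ one , [e₁-e₀]∧-supported one-free , [e₁-e₀]∧-cycle (λ _ → refl) ,
    λ x x-supported x-cycle → x (false ∷ true ∷ []) ,
      homologous-≈ʳ (homologous-to-[e₁-e₀]∧ x-supported x-cycle)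
        (λ T → trans (additive-cong [e₁-e₀]∧-additive (λ { [] → sym (*-identityʳ _) }) T)
                     ([e₁-e₀]∧-· _ one T))
    where
    one : PathChain 0
    one _ = 1#
    one-free : VanishesOff (IsMatchingFreeAtStart 0) one
    one-free [] ¬M = ⊥-elim (¬M isMatching-true∷[])

  dimAtMostOne-step : ∀ {m} → DimAtMostOne m → DimAtMostOne (suc (suc (suc m)))
  dimAtMostOne-step (z , z-supported , z-cycle , z-spans) =
    lift z , lift-supported z-supported , lift-cycle z-cycle , λ x x-supported x-cycle →
      let (y , y-supported , y-cycle , x∼lift-y) = cycle-homologous-to-lift x-supported x-cycle
          (a , y∼a·z) = z-spans y y-supported y-cycle
      in a , homologous-trans x∼lift-y (homologous-≈ʳ (lift-homologous y∼a·z) (lift-· a z))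

  acyclic-step : ∀ {m} → Acyclic m → Acyclic (suc (suc (suc m)))
  acyclic-step acyclic x x-supported x-cycle =
    let (y , y-supported , y-cycle , x∼lift-y) = cycle-homologous-to-lift x-supported x-cycle
        (b , b-supported , y≈∂b) = acyclic y y-supported y-cycle
        y∼0 = b , b-supported , λ S → trans (y≈∂b S) (sym (+-identityˡ _))
        (b′ , b′-supported , x≈lift0+∂b′) = homologous-trans x∼lift-y (lift-homologous y∼0)
    in b′ , b′-supported ,
       λ S → trans (x≈lift0+∂b′ S)
                   (trans (+-congʳ (additive-vanishes lift-additive (λ _ → refl) S)) (+-identityˡ _))

  path-homology : ∀ m → (suc m % 3 ≢ 2 → DimAtMostOne m) × (suc m % 3 ≡ 2 → Acyclic m)
  path-homology 0 = (λ _ → dimAtMostOne-0) , λ ()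
  path-homology 1 = (λ 2≢2 → ⊥-elim (2≢2 ≡.refl)) , λ _ → acyclic-1
  path-homology 2 = (λ _ → dimAtMostOne-2) , λ ()
  path-homology (suc (suc (suc m))) =
    let (dim , acyc) = path-homology m
    in (λ ≢2 → dimAtMostOne-step (dim (≢2 ∘ ≡.trans period))) ,
       (λ ≡2 → acyclic-step (acyc (≡.trans (≡.sym period) ≡2)))
    where
    period : suc (suc (suc (suc m))) % 3 ≡ suc m % 3
    period = %-remove-+ˡ {3} (suc m) {3} ∣-refl

lemma38 : {c ℓ : Level} (F : Field c ℓ) (m : ℕ) →
    ((suc m % 3 ≢ 2) → HomologyDimAtMostOne F (Path m) (allOnes (suc m))) ×
    ((suc m % 3 ≡ 2) → HomologyZero F (Path m) (allOnes (suc m)))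
lemma38 F = PathKoszul.path-homology F
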